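{- Let $d$ and $k$ be positive integers, and let $H \in \mathcal{H}(d,k)$. Then the fractional matching number of $H$ satisfies $\alpha'_*(H) = \frac{|V(H)|-k}{2}$.
   Context: All graphs are finite and simple. For positive integers $d,k$, $\mathcal{H}(d,k)$ denotes the family of connected bipartite graphs $H$ with bipartition $(A,B)$ such that (i) every vertex in $A$ has degree $d$, (ii) $|A| = |B| + k$, and (iii) all vertices in $B$ have the same degree. A fractional matching of a graph $G$ is a function $f: E(G)\to[0,1]$ such that $\sum_{e\in\Gamma(v)} f(e)\le 1$ for every $v\in V(G)$, where $\Gamma(v)$ is the set of edges incident to $v$. The fractional matching number $\alpha'_*(G)$ is the maximum of $\sum_{e\in E(G)} f(e)$ over all fractional matchings $f$ of $G$.
   Formalization: The fractional matchings over which $\alpha'_*(H)$ is maximised take rational values in $[0,1]$ rather than real ones. -}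

module Defs where

open import Data.Bool using (Bool; true; false; _∧_; _∨_; not)
open import Data.Nat as ℕ using (ℕ; _<ᵇ_)
open import Data.Fin using (Fin; toℕ; _≟_)
open import Data.List using (List; []; _∷_; map; filterᵇ; allFin; length; cartesianProduct; foldr)
open import Data.List.Membership.Propositional using (_∈_)
open import Data.Product using (_×_; _,_; proj₁; proj₂; ∃)
open import Data.Rational using (ℚ; 0ℚ; 1ℚ; _+_; _≤_)
open import Relation.Nullary.Decidable using (⌊_⌋)
open import Relation.Binary.PropositionalEquality using (_≡_; _≢_)

record Graph (n : ℕ) : Set where
  field
    adj    : Fin n → Fin n → Bool
    sym    : ∀ u v → adj u v ≡ adj v u
    irrefl : ∀ v → adj v v ≡ false
open Graph public

module _ {n : ℕ} (G : Graph n) where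

  -- The edge set E(G): each edge {u,v} listed once as the pair (u , v)
  -- with toℕ u < toℕ v.
  edges : List (Fin n × Fin n)
  edges = filterᵇ (λ e → (toℕ (proj₁ e) <ᵇ toℕ (proj₂ e)) ∧ adj G (proj₁ e) (proj₂ e))
                  (cartesianProduct (allFin n) (allFin n))

  incident : Fin n → List (Fin n × Fin n)
  incident v = filterᵇ (λ e → ⌊ proj₁ e ≟ v ⌋ ∨ ⌊ proj₂ e ≟ v ⌋) edges

  degree : Fin n → ℕ
  degree v = length (filterᵇ (adj G v) (allFin n))

  data Walk : Fin n → Fin n → Set where
    here : ∀ {v} → Walk v v
    step : ∀ {u w v} → adj G u w ≡ true → Walk w v → Walk u v

  Connected : Set
  Connected = ∀ u v → Walk u v

  IsBipartition : (Fin n → Bool) → Set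
  IsBipartition side = ∀ u v → adj G u v ≡ true → side u ≢ side v

  -- A function f : E(G) → ℚ, represented by its values f u v on pairs
  -- (u , v) ∈ edges.
  EdgeFun : Set
  EdgeFun = Fin n → Fin n → ℚ

  sumOver : EdgeFun → List (Fin n × Fin n) → ℚ
  sumOver f es = foldr (λ e acc → f (proj₁ e) (proj₂ e) + acc) 0ℚ es

  IsFractionalMatching : EdgeFun → Set
  IsFractionalMatching f =
      (∀ e → e ∈ edges → (0ℚ ≤ f (proj₁ e) (proj₂ e)) × (f (proj₁ e) (proj₂ e) ≤ 1ℚ))
    × (∀ v → sumOver f (incident v) ≤ 1ℚ)

  IsFractionalMatchingNumber : ℚ → Set
  IsFractionalMatchingNumber x =
      (∃ λ f → IsFractionalMatching f × sumOver f edges ≡ x)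
    × (∀ f → IsFractionalMatching f → sumOver f edges ≤ x)

sizeA : ∀ {n} → (Fin n → Bool) → ℕ
sizeA {n} side = length (filterᵇ side (allFin n))

sizeB : ∀ {n} → (Fin n → Bool) → ℕ
sizeB {n} side = length (filterᵇ (λ v → not (side v)) (allFin n))

-- Membership of (G , side) in ℋ(d,k), with A = side⁻¹(true), B = side⁻¹(false).
record InH (d k : ℕ) {n : ℕ} (G : Graph n) (side : Fin n → Bool) : Set where
  field
    connected   : Connected G
    bipartition : IsBipartition G side
    degA        : ∀ v → side v ≡ true → degree G v ≡ d
    sizes       : sizeA side ≡ sizeB side ℕ.+ k
    regB        : ∃ λ r → ∀ v → side v ≡ false → degree G v ≡ r

module Submission where

-- Every edge of a bipartite graph has exactly one end in B, so B is a fractional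
-- vertex cover and no fractional matching has weight above |B|.  Counting the
-- edges from both sides gives (|B| + k) d = |E| = |B| r, hence d < r and r is the
-- maximum degree.  The constant weight 1/r is therefore a fractional matching,
-- and its weight is |E| / r = |B|.  Since |V| = 2|B| + k this is (|V| - k) / 2.

open import Defs hiding (sym)
open import Algebra.Bundles using (CommutativeSemigroup)
open import Algebra.Structures using (IsCommutativeMonoid)
open import Data.Bool using (Bool; true; false; if_then_else_; _∧_; _∨_; not)
open import Data.Bool.Properties using (∨-comm; if-eta; not-injective)
open import Data.Empty using (⊥-elim)
open import Data.Fin using (Fin; zero; suc; toℕ; _≟_)
open import Data.Fin.Properties using (toℕ-injective; suc-injective)
open import Data.Integer as ℤ using (+_; _-_)
import Data.Integer.Properties as ℤ
open import Data.List using (List; []; _∷_; _++_; map; foldr; filterᵇ; length; allFin; tabulate; cartesianProduct)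
open import Data.List.Properties using (map-tabulate; length-tabulate)
open import Data.Nat as ℕ using (ℕ; zero; suc; _≥_; _<ᵇ_)
import Data.Nat.Properties as ℕ
open import Data.Nat.Coprimality using (1-coprimeTo)
import Data.Nat.Coprimality as Coprime
open import Data.Product using (_×_; _,_; proj₁; proj₂)
open import Data.Rational as ℚ using (ℚ; mkℚ; 0ℚ; 1ℚ; _/_; 1/_)
import Data.Rational.Properties as ℚ
open import Data.Rational.Unnormalised using (mkℚᵘ; *≡*)
open import Function using (_∘_; id)
open import Relation.Nullary using (yes; no)
open import Relation.Nullary.Decidable using (⌊_⌋)
open import Relation.Nullary.Reflects using (ofʸ; ofⁿ)
open import Relation.Binary.PropositionalEquality
  using (_≡_; _≢_; refl; sym; trans; cong; cong₂; subst; subst₂; module ≡-Reasoning)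
open ≡-Reasoning

module ListSum {C : Set} {_∙_ : C → C → C} {ε : C}
               (isCommutativeMonoid : IsCommutativeMonoid _≡_ _∙_ ε) where

  open IsCommutativeMonoid isCommutativeMonoid using (assoc; identityˡ; identityʳ; isCommutativeSemigroup)
  private
    semigroup : CommutativeSemigroup _ _
    semigroup = record { isCommutativeSemigroup = isCommutativeSemigroup }

  open import Algebra.Properties.CommutativeSemigroup semigroup using (interchange)

  private variable
    X Y : Set

  Σ : (X → C) → List X → C
  Σ h = foldr (λ x acc → h x ∙ acc) ε

  Σ-cong : {g h : X → C} → (∀ x → g x ≡ h x) → ∀ xs → Σ g xs ≡ Σ h xs
  Σ-cong g≗h []       = refl
  Σ-cong g≗h (x ∷ xs) = cong₂ _∙_ (g≗h x) (Σ-cong g≗h xs)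

  Σ-ε : ∀ (xs : List X) → Σ (λ _ → ε) xs ≡ ε
  Σ-ε []       = refl
  Σ-ε (x ∷ xs) = trans (identityˡ _) (Σ-ε xs)

  Σ-∙ : ∀ (g h : X → C) xs → Σ (λ x → g x ∙ h x) xs ≡ Σ g xs ∙ Σ h xs
  Σ-∙ g h []       = sym (identityˡ ε)
  Σ-∙ g h (x ∷ xs) = trans (cong ((g x ∙ h x) ∙_) (Σ-∙ g h xs)) (interchange _ _ _ _)

  Σ-++ : ∀ (h : X → C) xs ys → Σ h (xs ++ ys) ≡ Σ h xs ∙ Σ h ys
  Σ-++ h []       ys = sym (identityˡ _)
  Σ-++ h (x ∷ xs) ys = trans (cong (h x ∙_) (Σ-++ h xs ys)) (sym (assoc _ _ _))

  Σ-map : ∀ (h : Y → C) (g : X → Y) xs → Σ h (map g xs) ≡ Σ (h ∘ g) xs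
  Σ-map h g []       = refl
  Σ-map h g (x ∷ xs) = cong (h (g x) ∙_) (Σ-map h g xs)

  Σ-filterᵇ : ∀ (h : X → C) p xs → Σ h (filterᵇ p xs) ≡ Σ (λ x → if p x then h x else ε) xs
  Σ-filterᵇ h p []       = refl
  Σ-filterᵇ h p (x ∷ xs) with p x
  ... | true  = cong (h x ∙_) (Σ-filterᵇ h p xs)
  ... | false = trans (Σ-filterᵇ h p xs) (sym (identityˡ _))

  Σ-cong-filterᵇ : ∀ {g h : X → C} p → (∀ x → p x ≡ true → g x ≡ h x) →
                   ∀ xs → Σ g (filterᵇ p xs) ≡ Σ h (filterᵇ p xs)
  Σ-cong-filterᵇ p g≗h []       = refl
  Σ-cong-filterᵇ p g≗h (x ∷ xs) with p x in px
  ... | true  = cong₂ _∙_ (g≗h x px) (Σ-cong-filterᵇ p g≗h xs)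
  ... | false = Σ-cong-filterᵇ p g≗h xs

  if-Σ : ∀ b (g : X → C) xs → (if b then Σ g xs else ε) ≡ Σ (λ x → if b then g x else ε) xs
  if-Σ true  g xs = refl
  if-Σ false g xs = sym (Σ-ε xs)

  Σ-comm : ∀ (h : X → Y → C) xs ys →
           Σ (λ x → Σ (h x) ys) xs ≡ Σ (λ y → Σ (λ x → h x y) xs) ys
  Σ-comm h []       ys = sym (Σ-ε ys)
  Σ-comm h (x ∷ xs) ys = trans (cong (Σ (h x) ys ∙_) (Σ-comm h xs ys))
                               (sym (Σ-∙ (h x) (λ y → Σ (λ x′ → h x′ y) xs) ys))

  Σ-cartesianProduct : ∀ (h : X × Y → C) xs ys →
                       Σ h (cartesianProduct xs ys) ≡ Σ (λ x → Σ (λ y → h (x , y)) ys) xs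
  Σ-cartesianProduct h []       ys = refl
  Σ-cartesianProduct h (x ∷ xs) ys =
    trans (Σ-++ h (map (x ,_) ys) _) (cong₂ _∙_ (Σ-map h (x ,_) ys) (Σ-cartesianProduct h xs ys))

  Σ-allFin-suc : ∀ {n} (h : Fin (suc n) → C) → Σ h (allFin (suc n)) ≡ h zero ∙ Σ (h ∘ suc) (allFin n)
  Σ-allFin-suc {n} h =
    cong (h zero ∙_) (trans (cong (Σ h) (sym (map-tabulate id suc))) (Σ-map h suc (allFin n)))

  Σ-allFin-single : ∀ {n} (h : Fin n → C) c → (∀ v → v ≢ c → h v ≡ ε) → Σ h (allFin n) ≡ h c
  Σ-allFin-single {suc n} h zero vanish = begin
    Σ h (allFin (suc n))            ≡⟨ Σ-allFin-suc h ⟩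
    h zero ∙ Σ (h ∘ suc) (allFin n) ≡⟨ cong (h zero ∙_) (Σ-cong (λ v → vanish (suc v) λ ()) (allFin n)) ⟩
    h zero ∙ Σ (λ _ → ε) (allFin n) ≡⟨ cong (h zero ∙_) (Σ-ε (allFin n)) ⟩
    h zero ∙ ε                      ≡⟨ identityʳ _ ⟩
    h zero                          ∎
  Σ-allFin-single {suc n} h (suc c) vanish = begin
    Σ h (allFin (suc n))            ≡⟨ Σ-allFin-suc h ⟩
    h zero ∙ Σ (h ∘ suc) (allFin n) ≡⟨ cong₂ _∙_ (vanish zero λ ())
                                         (Σ-allFin-single (h ∘ suc) c
                                            λ v v≢c → vanish (suc v) (v≢c ∘ suc-injective)) ⟩
    ε ∙ h (suc c)                   ≡⟨ identityˡ _ ⟩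
    h (suc c)                       ∎

  Σ-allFin-δ : ∀ {n} (c : Fin n) x → Σ (λ u → if ⌊ u ≟ c ⌋ then x else ε) (allFin n) ≡ x
  Σ-allFin-δ c x = trans (Σ-allFin-single _ c vanish-off-c) at-c
    where
    vanish-off-c : ∀ u → u ≢ c → (if ⌊ u ≟ c ⌋ then x else ε) ≡ ε
    vanish-off-c u u≢c with u ≟ c
    ... | yes u≡c = ⊥-elim (u≢c u≡c)
    ... | no _    = refl
    at-c : (if ⌊ c ≟ c ⌋ then x else ε) ≡ x
    at-c with c ≟ c
    ... | yes _   = refl
    ... | no c≢c  = ⊥-elim (c≢c refl)

module ℕΣ = ListSum ℕ.+-0-isCommutativeMonoid

length≡Σ1 : ∀ {X : Set} (xs : List X) → length xs ≡ ℕΣ.Σ (λ _ → 1) xs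
length≡Σ1 []       = refl
length≡Σ1 (x ∷ xs) = cong suc (length≡Σ1 xs)

length-filterᵇ≡Σ : ∀ {X : Set} p (xs : List X) →
                   length (filterᵇ p xs) ≡ ℕΣ.Σ (λ x → if p x then 1 else 0) xs
length-filterᵇ≡Σ p xs = trans (length≡Σ1 (filterᵇ p xs)) (ℕΣ.Σ-filterᵇ (λ _ → 1) p xs)

Σ-const-ℕ : ∀ {X : Set} c (xs : List X) → ℕΣ.Σ (λ _ → c) xs ≡ length xs ℕ.* c
Σ-const-ℕ c []       = refl
Σ-const-ℕ c (x ∷ xs) = cong (c ℕ.+_) (Σ-const-ℕ c xs)

length-filterᵇ-not : ∀ {X : Set} p (xs : List X) →
                     length (filterᵇ p xs) ℕ.+ length (filterᵇ (not ∘ p) xs) ≡ length xs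
length-filterᵇ-not p []       = refl
length-filterᵇ-not p (x ∷ xs) with p x
... | true  = cong suc (length-filterᵇ-not p xs)
... | false = trans (ℕ.+-suc _ _) (cong suc (length-filterᵇ-not p xs))

sizeA+sizeB≡n : ∀ {n} (side : Fin n → Bool) → sizeA side ℕ.+ sizeB side ≡ n
sizeA+sizeB≡n {n} side = trans (length-filterᵇ-not side (allFin n)) (length-tabulate id)

verticesWith : ∀ {n} → (Fin n → Bool) → List (Fin n)
verticesWith {n} σ = filterᵇ σ (allFin n)

<ᵇ-irrefl : ∀ m → (m <ᵇ m) ≡ false
<ᵇ-irrefl zero    = refl
<ᵇ-irrefl (suc m) = <ᵇ-irrefl m

module _ {n : ℕ} (G : Graph n) where

  isEdge : Fin n × Fin n → Bool
  isEdge (a , b) = (toℕ a <ᵇ toℕ b) ∧ adj G a b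

  isEndpoint : Fin n → Fin n × Fin n → Bool
  isEndpoint v (a , b) = ⌊ a ≟ v ⌋ ∨ ⌊ b ≟ v ⌋

  isEdge⇒adj : ∀ a b → isEdge (a , b) ≡ true → adj G a b ≡ true
  isEdge⇒adj a b e with toℕ a <ᵇ toℕ b
  ... | true = e

  edgeCount : Fin n → Fin n → ℕ
  edgeCount u w = if isEdge (u , w) then 1 else 0

  edgeCount-split : ∀ v a b →
    (if isEdge (a , b) then (if isEndpoint v (a , b) then 1 else 0) else 0)
      ≡ (if ⌊ a ≟ v ⌋ then edgeCount v b else 0) ℕ.+ (if ⌊ b ≟ v ⌋ then edgeCount a v else 0)
  edgeCount-split v a b with a ≟ v | b ≟ v
  ... | yes refl | yes refl rewrite <ᵇ-irrefl (toℕ a) = refl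
  ... | yes refl | no _     = sym (ℕ.+-identityʳ _)
  ... | no _     | yes refl = refl
  ... | no _     | no _     = if-eta (isEdge (a , b))

  edgeCount-sym : ∀ v w → edgeCount v w ℕ.+ edgeCount w v ≡ (if adj G v w then 1 else 0)
  edgeCount-sym v w with toℕ v <ᵇ toℕ w | ℕ.<ᵇ-reflects-< (toℕ v) (toℕ w)
                       | toℕ w <ᵇ toℕ v | ℕ.<ᵇ-reflects-< (toℕ w) (toℕ v)
  ... | true  | ofʸ v<w | true  | ofʸ w<v = ⊥-elim (ℕ.<-asym v<w w<v)
  ... | true  | _       | false | _       = ℕ.+-identityʳ _
  ... | false | _       | true  | _       = cong (λ b → if b then 1 else 0) (Graph.sym G w v)
  ... | false | ofⁿ v≮w | false | ofⁿ w≮v = sym (cong (λ b → if b then 1 else 0) no-loop)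
    where
    no-loop : adj G v w ≡ false
    no-loop = subst (λ u → adj G v u ≡ false)
                    (toℕ-injective (ℕ.≤-antisym (ℕ.≮⇒≥ w≮v) (ℕ.≮⇒≥ v≮w)))
                    (irrefl G v)

  length-incident≡Σ : ∀ v → length (incident G v) ≡
                      ℕΣ.Σ (edgeCount v) (allFin n) ℕ.+ ℕΣ.Σ (λ u → edgeCount u v) (allFin n)
  length-incident≡Σ v = begin
    length (filterᵇ (isEndpoint v) (filterᵇ isEdge L))
      ≡⟨ length-filterᵇ≡Σ (isEndpoint v) (edges G) ⟩
    Σ (λ e → if isEndpoint v e then 1 else 0) (filterᵇ isEdge L)
      ≡⟨ Σ-filterᵇ _ isEdge L ⟩
    Σ (λ e → if isEdge e then (if isEndpoint v e then 1 else 0) else 0) L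
      ≡⟨ Σ-cartesianProduct _ V V ⟩
    Σ (λ a → Σ (λ b → if isEdge (a , b) then (if isEndpoint v (a , b) then 1 else 0) else 0) V) V
      ≡⟨ Σ-cong (λ a → trans (Σ-cong (edgeCount-split v a) V) (Σ-∙ _ _ V)) V ⟩
    Σ (λ a → Σ (λ b → if ⌊ a ≟ v ⌋ then edgeCount v b else 0) V
             ℕ.+ Σ (λ b → if ⌊ b ≟ v ⌋ then edgeCount a v else 0) V) V
      ≡⟨ Σ-∙ _ _ V ⟩
    Σ (λ a → Σ (λ b → if ⌊ a ≟ v ⌋ then edgeCount v b else 0) V) V
      ℕ.+ Σ (λ a → Σ (λ b → if ⌊ b ≟ v ⌋ then edgeCount a v else 0) V) V
      ≡⟨ cong₂ ℕ._+_ (trans (Σ-cong (λ a → sym (if-Σ ⌊ a ≟ v ⌋ (edgeCount v) V)) V) (Σ-allFin-δ v _))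
                     (Σ-cong (λ a → Σ-allFin-δ v (edgeCount a v)) V) ⟩
    Σ (edgeCount v) V ℕ.+ Σ (λ u → edgeCount u v) V ∎
    where
    open ℕΣ
    V = allFin n
    L = cartesianProduct V V

  length-incident : ∀ v → length (incident G v) ≡ degree G v
  length-incident v = begin
    length (incident G v)                                   ≡⟨ length-incident≡Σ v ⟩
    Σ (edgeCount v) V ℕ.+ Σ (λ u → edgeCount u v) V         ≡⟨ Σ-∙ _ _ V ⟨
    Σ (λ w → edgeCount v w ℕ.+ edgeCount w v) V             ≡⟨ Σ-cong (edgeCount-sym v) V ⟩
    Σ (λ w → if adj G v w then 1 else 0) V                  ≡⟨ length-filterᵇ≡Σ (adj G v) V ⟨
    degree G v                                              ∎
    where
    open ℕΣ
    V = allFin n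

  IsBipartition-not : ∀ {σ} → IsBipartition G σ → IsBipartition G (not ∘ σ)
  IsBipartition-not bip u v u~v = bip u v u~v ∘ not-injective

  module _ {C : Set} {_∙_ : C → C → C} {ε : C}
           (isCommutativeMonoid : IsCommutativeMonoid _≡_ _∙_ ε)
           {σ : Fin n → Bool} (bip : IsBipartition G σ) where

    open ListSum isCommutativeMonoid

    private
      atSideEndpoint : (Fin n × Fin n → C) → Fin n → Fin n × Fin n → C
      atSideEndpoint h v e = if σ v then (if isEndpoint v e then h e else ε) else ε

      atSideEndpoint-single : ∀ h a b → σ a ≡ true → σ b ≡ false →
                              ∀ v → v ≢ a → atSideEndpoint h v (a , b) ≡ ε
      atSideEndpoint-single h a b σa σb v v≢a with a ≟ v | b ≟ v
      ... | yes refl | _        = ⊥-elim (v≢a refl)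
      ... | no _     | yes refl rewrite σb = refl
      ... | no _     | no _     = if-eta (σ v)

      Σ-atSideEndpoint-oriented : ∀ h a b → σ a ≡ true → σ b ≡ false →
                                  Σ (λ v → atSideEndpoint h v (a , b)) (allFin n) ≡ h (a , b)
      Σ-atSideEndpoint-oriented h a b σa σb =
        trans (Σ-allFin-single _ a (atSideEndpoint-single h a b σa σb)) at-a
        where
        at-a : atSideEndpoint h a (a , b) ≡ h (a , b)
        at-a with a ≟ a
        ... | yes _   rewrite σa = refl
        ... | no a≢a  = ⊥-elim (a≢a refl)

      Σ-atSideEndpoint : ∀ h a b → σ a ≢ σ b →
                         Σ (λ v → atSideEndpoint h v (a , b)) (allFin n) ≡ h (a , b)
      Σ-atSideEndpoint h a b σa≢σb with σ a in σa | σ b in σb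
      ... | true  | true  = ⊥-elim (σa≢σb refl)
      ... | false | false = ⊥-elim (σa≢σb refl)
      ... | true  | false = Σ-atSideEndpoint-oriented h a b σa σb
      ... | false | true  = trans (Σ-cong endpoints-swap (allFin n))
                                 (Σ-atSideEndpoint-oriented (λ (b , a) → h (a , b)) b a σb σa)
        where
        endpoints-swap : ∀ v → atSideEndpoint h v (a , b) ≡ atSideEndpoint (λ (b , a) → h (a , b)) v (b , a)
        endpoints-swap v =
          cong (λ t → if σ v then (if t then h (a , b) else ε) else ε) (∨-comm ⌊ a ≟ v ⌋ ⌊ b ≟ v ⌋)

    Σ-edges≡Σ-verticesWith-incident : ∀ (h : Fin n × Fin n → C) →
                                      Σ h (edges G) ≡ Σ (λ v → Σ h (incident G v)) (verticesWith σ)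
    Σ-edges≡Σ-verticesWith-incident h = sym (begin
      Σ (λ v → Σ h (filterᵇ (isEndpoint v) (edges G))) (verticesWith σ)
        ≡⟨ Σ-filterᵇ _ σ V ⟩
      Σ (λ v → if σ v then Σ h (filterᵇ (isEndpoint v) (edges G)) else ε) V
        ≡⟨ Σ-cong (λ v → trans (cong (λ s → if σ v then s else ε) (Σ-filterᵇ h (isEndpoint v) (edges G)))
                               (if-Σ (σ v) _ (edges G))) V ⟩
      Σ (λ v → Σ (atSideEndpoint h v) (edges G)) V
        ≡⟨ Σ-comm (atSideEndpoint h) V (edges G) ⟩
      Σ (λ e → Σ (λ v → atSideEndpoint h v e) V) (edges G)
        ≡⟨ Σ-cong-filterᵇ isEdge (λ (a , b) e → Σ-atSideEndpoint h a b (bip a b (isEdge⇒adj a b e)))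
                          (cartesianProduct V V) ⟩
      Σ h (edges G) ∎)
      where
      V = allFin n

  edge-count : ∀ {σ} → IsBipartition G σ → ∀ r → (∀ v → σ v ≡ true → degree G v ≡ r) →
               length (edges G) ≡ length (verticesWith σ) ℕ.* r
  edge-count {σ} bip r deg≡r = begin
    length (edges G)
      ≡⟨ length≡Σ1 (edges G) ⟩
    Σ (λ _ → 1) (edges G)
      ≡⟨ Σ-edges≡Σ-verticesWith-incident ℕ.+-0-isCommutativeMonoid bip _ ⟩
    Σ (λ v → Σ (λ _ → 1) (incident G v)) (verticesWith σ)
      ≡⟨ Σ-cong-filterᵇ σ degree≡r (allFin n) ⟩
    Σ (λ _ → r) (verticesWith σ)
      ≡⟨ Σ-const-ℕ r (verticesWith σ) ⟩
    length (verticesWith σ) ℕ.* r ∎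
    where
    open ℕΣ
    degree≡r : ∀ v → σ v ≡ true → Σ (λ _ → 1) (incident G v) ≡ r
    degree≡r v σv = trans (sym (length≡Σ1 (incident G v))) (trans (length-incident v) (deg≡r v σv))

-- A literal mkℚ rather than + m / 1, so that ι a + ι b and ι a * ι b reduce to fractions over 1.
ι : ℕ → ℚ
ι m = mkℚ (+ m) 0 (Coprime.sym (1-coprimeTo m))

ι-+ : ∀ a b → ι a ℚ.+ ι b ≡ ι (a ℕ.+ b)
ι-+ a b = begin
  ι a ℚ.+ ι b                        ≡⟨⟩
  (+ a ℤ.* + 1 ℤ.+ + b ℤ.* + 1) / 1  ≡⟨ cong (_/ 1) (cong₂ ℤ._+_ (ℤ.*-identityʳ (+ a)) (ℤ.*-identityʳ (+ b))) ⟩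
  + (a ℕ.+ b) / 1                    ≡⟨ ℚ.normalize-coprime (Coprime.sym (1-coprimeTo (a ℕ.+ b))) ⟩
  ι (a ℕ.+ b)                        ∎

ι-* : ∀ a b → ι a ℚ.* ι b ≡ ι (a ℕ.* b)
ι-* a b = begin
  ι a ℚ.* ι b       ≡⟨⟩
  (+ a ℤ.* + b) / 1 ≡⟨ cong (_/ 1) (sym (ℤ.pos-* a b)) ⟩
  + (a ℕ.* b) / 1   ≡⟨ ℚ.normalize-coprime (Coprime.sym (1-coprimeTo (a ℕ.* b))) ⟩
  ι (a ℕ.* b)       ∎

ι-mono-≤ : ∀ {a b} → a ℕ.≤ b → ι a ℚ.≤ ι b
ι-mono-≤ {a} {b} a≤b =
  ℚ.*≤* (subst₂ ℤ._≤_ (sym (ℤ.*-identityʳ (+ a))) (sym (ℤ.*-identityʳ (+ b))) (ℤ.+≤+ a≤b))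

+[m+m]/2≡ι : ∀ m → + (m ℕ.+ m) / 2 ≡ ι m
+[m+m]/2≡ι m = begin
  + (m ℕ.+ m) / 2   ≡⟨ ℚ.fromℚᵘ-cong {mkℚᵘ (+ (m ℕ.+ m)) 1} {mkℚᵘ (+ m) 0} (*≡* cross) ⟩
  + m / 1           ≡⟨ ℚ.fromℚᵘ-toℚᵘ (ι m) ⟩
  ι m               ∎
  where
  cross : + (m ℕ.+ m) ℤ.* + 1 ≡ + m ℤ.* + 2
  cross = begin
    + (m ℕ.+ m) ℤ.* + 1   ≡⟨ ℤ.*-identityʳ (+ (m ℕ.+ m)) ⟩
    + (m ℕ.+ m)           ≡⟨ cong (λ i → + (m ℕ.+ i)) (ℕ.+-identityʳ m) ⟨
    + (2 ℕ.* m)           ≡⟨ cong +_ (ℕ.*-comm 2 m) ⟩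
    + (m ℕ.* 2)           ≡⟨ ℤ.pos-* m 2 ⟩
    + m ℤ.* + 2           ∎

+[k+i]-+k≡+i : ∀ k i → + (k ℕ.+ i) - + k ≡ + i
+[k+i]-+k≡+i k i = begin
  + (k ℕ.+ i) - + k        ≡⟨ ℤ.[+m]-[+n]≡m⊖n (k ℕ.+ i) k ⟩
  (k ℕ.+ i) ℤ.⊖ k          ≡⟨ ℤ.⊖-≥ (ℕ.m≤m+n k i) ⟩
  + (k ℕ.+ i ℕ.∸ k)        ≡⟨ cong +_ (ℕ.m+n∸m≡n k i) ⟩
  + i                      ∎

1/ι-suc-nonNeg : ∀ r → ℚ.NonNegative (1/ ι (suc r))
1/ι-suc-nonNeg r = ℚ.pos⇒nonNeg (1/ ι (suc r)) {{ℚ.1/pos⇒pos (ι (suc r))}}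

ι-*-1/-≤1 : ∀ {a} r → a ℕ.≤ suc r → ι a ℚ.* 1/ ι (suc r) ℚ.≤ 1ℚ
ι-*-1/-≤1 r a≤r = ℚ.≤-trans (ℚ.*-monoʳ-≤-nonNeg (1/ ι (suc r)) {{1/ι-suc-nonNeg r}} (ι-mono-≤ a≤r))
                            (ℚ.≤-reflexive (ℚ.*-inverseʳ (ι (suc r))))

module ℚΣ = ListSum ℚ.+-0-isCommutativeMonoid

Σ-const-ℚ : ∀ {X : Set} c (xs : List X) → ℚΣ.Σ (λ _ → c) xs ≡ ι (length xs) ℚ.* c
Σ-const-ℚ c []       = sym (ℚ.*-zeroˡ c)
Σ-const-ℚ c (x ∷ xs) = begin
  c ℚ.+ ℚΣ.Σ (λ _ → c) xs              ≡⟨ cong (c ℚ.+_) (Σ-const-ℚ c xs) ⟩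
  c ℚ.+ ι (length xs) ℚ.* c            ≡⟨ cong (ℚ._+ (ι (length xs) ℚ.* c)) (ℚ.*-identityˡ c) ⟨
  1ℚ ℚ.* c ℚ.+ ι (length xs) ℚ.* c     ≡⟨ ℚ.*-distribʳ-+ c 1ℚ (ι (length xs)) ⟨
  (1ℚ ℚ.+ ι (length xs)) ℚ.* c         ≡⟨ cong (ℚ._* c) (ι-+ 1 (length xs)) ⟩
  ι (suc (length xs)) ℚ.* c            ∎

Σ-1≡ι-length : ∀ {X : Set} (xs : List X) → ℚΣ.Σ (λ _ → 1ℚ) xs ≡ ι (length xs)
Σ-1≡ι-length xs = trans (Σ-const-ℚ 1ℚ xs) (ℚ.*-identityʳ (ι (length xs)))

Σ-mono-≤ : ∀ {X : Set} {g h : X → ℚ} → (∀ x → g x ℚ.≤ h x) → ∀ xs → ℚΣ.Σ g xs ℚ.≤ ℚΣ.Σ h xs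
Σ-mono-≤ g≤h []       = ℚ.≤-refl
Σ-mono-≤ g≤h (x ∷ xs) = ℚ.+-mono-≤ (g≤h x) (Σ-mono-≤ g≤h xs)

module _ {n : ℕ} (G : Graph n) where

  fractionalMatching-weight-≤-side : ∀ {σ} → IsBipartition G σ → ∀ {f} → IsFractionalMatching G f →
                              sumOver G f (edges G) ℚ.≤ ι (length (verticesWith σ))
  fractionalMatching-weight-≤-side {σ} bip {f} (_ , f-vertex≤1) =
    subst (ℚ._≤ _) (sym (Σ-edges≡Σ-verticesWith-incident G ℚ.+-0-isCommutativeMonoid bip (λ (u , v) → f u v)))
          (ℚ.≤-trans (Σ-mono-≤ f-vertex≤1 (verticesWith σ))
                     (ℚ.≤-reflexive (Σ-1≡ι-length (verticesWith σ))))

  constant-isFractionalMatching : ∀ r → (∀ v → degree G v ℕ.≤ suc r) →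
                                  IsFractionalMatching G (λ _ _ → 1/ ι (suc r))
  constant-isFractionalMatching r Δ≤r = (λ _ _ → 0≤1/r , 1/r≤1) , vertex≤1
    where
    1/r = 1/ ι (suc r)
    0≤1/r : 0ℚ ℚ.≤ 1/ ι (suc r)
    0≤1/r = ℚ.nonNegative⁻¹ 1/r {{1/ι-suc-nonNeg r}}
    1/r≤1 : 1/ ι (suc r) ℚ.≤ 1ℚ
    1/r≤1 = subst (ℚ._≤ 1ℚ) (ℚ.*-identityˡ 1/r) (ι-*-1/-≤1 r (ℕ.s≤s ℕ.z≤n))
    vertex≤1 : ∀ v → sumOver G (λ _ _ → 1/ ι (suc r)) (incident G v) ℚ.≤ 1ℚ
    vertex≤1 v = subst (ℚ._≤ 1ℚ) (sym weight≡) (ι-*-1/-≤1 r (Δ≤r v))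
      where
      weight≡ : sumOver G (λ _ _ → 1/r) (incident G v) ≡ ι (degree G v) ℚ.* 1/r
      weight≡ = trans (Σ-const-ℚ 1/r (incident G v)) (cong (λ d → ι d ℚ.* 1/r) (length-incident G v))

  isFractionalMatchingNumber-side : ∀ {σ} → IsBipartition G σ → ∀ r → 0 ℕ.< r →
                                  (∀ v → degree G v ℕ.≤ r) → (∀ v → σ v ≡ true → degree G v ≡ r) →
                                  IsFractionalMatchingNumber G (ι (length (verticesWith σ)))
  isFractionalMatchingNumber-side {σ} bip (suc r) _ Δ≤r deg≡r =
    ((λ _ _ → 1/ ι (suc r)) , constant-isFractionalMatching r Δ≤r , weight) ,
    λ _ → fractionalMatching-weight-≤-side bip
    where
    s = length (verticesWith σ)
    1/r = 1/ ι (suc r)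
    weight : sumOver G (λ _ _ → 1/ ι (suc r)) (edges G) ≡ ι s
    weight = begin
      sumOver G (λ _ _ → 1/ ι (suc r)) (edges G) ≡⟨ Σ-const-ℚ 1/r (edges G) ⟩
      ι (length (edges G)) ℚ.* 1/ ι (suc r)      ≡⟨ cong (λ e → ι e ℚ.* 1/r) (edge-count G bip (suc r) deg≡r) ⟩
      ι (s ℕ.* suc r) ℚ.* 1/ ι (suc r)           ≡⟨ cong (ℚ._* 1/r) (ι-* s (suc r)) ⟨
      ι s ℚ.* ι (suc r) ℚ.* 1/ ι (suc r)         ≡⟨ ℚ.*-assoc (ι s) (ι (suc r)) 1/r ⟩
      ι s ℚ.* (ι (suc r) ℚ.* 1/ ι (suc r))       ≡⟨ cong (ι s ℚ.*_) (ℚ.*-inverseʳ (ι (suc r))) ⟩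
      ι s ℚ.* 1ℚ                                 ≡⟨ ℚ.*-identityʳ (ι s) ⟩
      ι s                                        ∎

[m+k]*d≡m*r⇒d<r : ∀ {m k d r} → 0 ℕ.< k → 0 ℕ.< d → (m ℕ.+ k) ℕ.* d ≡ m ℕ.* r → d ℕ.< r
[m+k]*d≡m*r⇒d<r {m} {k} {d} {r} 0<k 0<d [m+k]d≡mr =
  ℕ.≰⇒> λ r≤d → ℕ.<-irrefl refl (ℕ.<-≤-trans md<mr (ℕ.*-monoʳ-≤ m r≤d))
  where
  md<mr : m ℕ.* d ℕ.< m ℕ.* r
  md<mr = subst (m ℕ.* d ℕ.<_) (trans (sym (ℕ.*-distribʳ-+ d m k)) [m+k]d≡mr)
                (ℕ.m<m+n (m ℕ.* d) (ℕ.*-mono-≤ 0<k 0<d))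

lemma2p3 : (d k : ℕ) → d ≥ 1 → k ≥ 1 → (n : ℕ) (H : Graph n) (side : Fin n → Bool) →
           InH d k H side → IsFractionalMatchingNumber H ((+ n - + k) / 2)
lemma2p3 d k d≥1 k≥1 n H side inH =
  subst (IsFractionalMatchingNumber H) (sym (½[|V|-k]≡|B|))
        (isFractionalMatchingNumber-side H B-bipartition r (ℕ.<-≤-trans d≥1 (ℕ.<⇒≤ d<r)) Δ≤r degB)
  where
  open InH inH
  r = proj₁ regB
  m = sizeB side
  B-bipartition : IsBipartition H (not ∘ side)
  B-bipartition = IsBipartition-not H bipartition
  degB : ∀ v → not (side v) ≡ true → degree H v ≡ r
  degB v = proj₂ regB v ∘ not-injective
  d<r : d ℕ.< r
  d<r = [m+k]*d≡m*r⇒d<r {m} k≥1 d≥1 (begin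
    (m ℕ.+ k) ℕ.* d           ≡⟨ cong (ℕ._* d) sizes ⟨
    sizeA side ℕ.* d          ≡⟨ edge-count H bipartition d degA ⟨
    length (edges H)          ≡⟨ edge-count H B-bipartition r degB ⟩
    m ℕ.* r                   ∎)
  Δ≤r : ∀ v → degree H v ℕ.≤ r
  Δ≤r v with side v in sv
  ... | true  = ℕ.≤-trans (ℕ.≤-reflexive (degA v sv)) (ℕ.<⇒≤ d<r)
  ... | false = ℕ.≤-reflexive (proj₂ regB v sv)
  ½[|V|-k]≡|B| : (+ n - + k) / 2 ≡ ι m
  ½[|V|-k]≡|B| = begin
    (+ n - + k) / 2                 ≡⟨ cong (λ i → (+ i - + k) / 2) |V|≡k+2|B| ⟩
    (+ (k ℕ.+ (m ℕ.+ m)) - + k) / 2 ≡⟨ cong (_/ 2) (+[k+i]-+k≡+i k (m ℕ.+ m)) ⟩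
    + (m ℕ.+ m) / 2                 ≡⟨ +[m+m]/2≡ι m ⟩
    ι m                             ∎
    where
    |V|≡k+2|B| : n ≡ k ℕ.+ (m ℕ.+ m)
    |V|≡k+2|B| = begin
      n                    ≡⟨ sizeA+sizeB≡n side ⟨
      sizeA side ℕ.+ m     ≡⟨ cong (ℕ._+ m) sizes ⟩
      m ℕ.+ k ℕ.+ m        ≡⟨ cong (ℕ._+ m) (ℕ.+-comm m k) ⟩
      k ℕ.+ m ℕ.+ m        ≡⟨ ℕ.+-assoc k m m ⟩
      k ℕ.+ (m ℕ.+ m)      ∎
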